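{- Let $n\ge1$, let $J\subseteq S_n^A=\{s_1,\ldots,s_{n-1}\}$, and write $x\sim_J y$ if $x$ and $y$ lie in the same left coset of the parabolic subgroup $\mathfrak S_J$ of $\mathfrak S_n$ (i.e. $x\mathfrak S_J=y\mathfrak S_J$). Then for every $s\in S_n^A$ and all $x,v\in\mathfrak S_n$: if $vsx\sim_J x$ and $x\not\sim_J sx$, then $s\in\mathrm{rw}(v)$.
   Context: $\mathfrak S_n$ is the symmetric group with Coxeter generators $s_i=(i,i+1)$; $\mathfrak S_J$ is the subgroup generated by $J$. For $v\in\mathfrak S_n$, $\mathrm{rw}(v)$ is the set of generators occurring in a reduced expression of $v$ (this set does not depend on the reduced expression). Permutations are multiplied from right to left. -}

module Defs where

open import Data.Nat using (ℕ; _≤_)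
import Data.Nat as N
open import Data.Fin using (Fin; inject₁; suc)
open import Data.Fin.Subset using (Subset; _∈_)
open import Data.Fin.Permutation using (Permutation′; _⟨$⟩ʳ_; _∘ₚ_; transpose)
import Data.Fin.Permutation as P
open import Data.List using (List; []; _∷_; length)
open import Data.List.Relation.Unary.All using (All)
import Data.List.Membership.Propositional as LM
open import Data.Product using (∃-syntax; _×_)
open import Relation.Binary.PropositionalEquality using (_≡_)

Perm : ℕ → Set
Perm n = Permutation′ n

-- Product, right to left: (p · q)(i) = p (q i).
infixl 7 _·_
_·_ : ∀ {n} → Perm n → Perm n → Perm n
p · q = q ∘ₚ p

infix 4 _≈_
_≈_ : ∀ {n} → Perm n → Perm n → Set
p ≈ q = ∀ i → p ⟨$⟩ʳ i ≡ q ⟨$⟩ʳ i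

-- Coxeter generators of S_{suc m}: for k : Fin m (0-based), gen k swaps
-- positions k and k+1, i.e. gen k = s_{k+1} in the paper's 1-based numbering.
gen : ∀ {m} → Fin m → Perm (N.suc m)
gen k = transpose (inject₁ k) (suc k)

eval : ∀ {m} → List (Fin m) → Perm (N.suc m)
eval []      = P.id
eval (k ∷ w) = gen k · eval w

InParabolic : ∀ {m} → Subset m → Perm (N.suc m) → Set
InParabolic J u = ∃[ w ] (All (_∈ J) w × eval w ≈ u)

-- x ∼_J y  iff  x S_J = y S_J  iff  y ∈ x S_J  iff  y = x u for some u ∈ S_J.
SameCoset : ∀ {m} → Subset m → Perm (N.suc m) → Perm (N.suc m) → Set
SameCoset J x y = ∃[ u ] (InParabolic J u × (x · u) ≈ y)

Reduced : ∀ {m} → List (Fin m) → Perm (N.suc m) → Set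
Reduced w v = eval w ≈ v × (∀ w′ → eval w′ ≈ v → length w ≤ length w′)

-- s ∈ rw(v): s occurs in (every, equivalently any) reduced expression of v.
InRw : ∀ {m} → Fin m → Perm (N.suc m) → Set
InRw s v = ∀ w → Reduced w v → s LM.∈ w

-- For subsets J, K of the generators, the number of positions in the β-th block of J that a
-- permutation p sends into the γ-th block of K does not change when p is replaced by any element of
-- the double coset S_K p S_J. Take K = S ∖ {s}: if s occurs in no word for v, then v ∈ S_K and
-- x = v s x u puts x and s x into the same double coset. Let a and b be the positions that x sends to
-- the two points swapped by s. If a and b lie in the same block of J, the transposition (a b) lies in
-- S_J and x (a b) = s x. Otherwise passing from x to s x only moves a from the K-block γ of s into
-- block γ + 1, so the count for the J-block of a and γ drops.

module Submission where

open import Defs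
open import Data.Nat using (ℕ; suc)
open import Data.Fin using (Fin)
open import Data.Fin.Subset using (Subset)
open import Relation.Nullary using (¬_)

open import Data.Bool using (Bool; true; false; T; if_then_else_; _∧_)
open import Data.Bool.Properties using (T-∧)
open import Data.Empty using (⊥-elim)
open import Data.Fin as F using (toℕ; inject₁; fromℕ<)
open import Data.Fin.Permutation using (_⟨$⟩ʳ_; _⟨$⟩ˡ_; inverseʳ)
import Data.Fin.Permutation as P
import Data.Fin.Permutation.Components as PC
open import Data.Fin.Properties using (toℕ-injective; toℕ-inject₁; toℕ-fromℕ<; toℕ<n)
open import Data.Fin.Subset using (_∈_; _∉_; ∁; ⁅_⁆; inside; outside)
open import Data.Fin.Subset.Properties using (_∈?_; x∉p⇒x∈∁p; x∈p⇒x∉∁p; x∈⁅x⁆; x≢y⇒x∉⁅y⁆)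
open import Data.List using (List; []; _∷_; _++_)
open import Data.List.Relation.Unary.All as All using (All; []; _∷_)
open import Data.List.Relation.Unary.All.Properties using (++⁺; ¬Any⇒All¬)
open import Data.List.Relation.Unary.Any using (Any; any?)
open import Data.Nat using (zero; _≤_; _<_; z≤n; s≤s; _≡ᵇ_; _≟_)
open import Data.Nat.Properties
  using ( +-0-commutativeMonoid; ≤-refl; ≤-trans; ≤-pred; n≤1+n; n<1+n; m<n⇒m<1+n; m≤n⇒m<n∨m≡n
        ; <⇒≢; <-cmp; <-irrefl; 1+n≢n; ≡ᵇ⇒≡; ≡⇒≡ᵇ; +-mono-≤; +-mono-<-≤; +-mono-≤-<; module ≤-Reasoning)
open import Algebra.Properties.CommutativeMonoid.Sum +-0-commutativeMonoid
  using (sum; sum-permute; sum-cong-≗)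
open import Data.Product using (∃-syntax; _×_; _,_; proj₂)
open import Data.Sum using (_⊎_; inj₁; inj₂)
open import Data.Vec using ([]; _∷_; here; there)
open import Function using (_∘_; Injective; Equivalence; Injection)
open import Function.Properties.Inverse using (↔⇒↣)
open import Relation.Binary using (DecidableEquality; tri<; tri≈; tri>)
open import Relation.Binary.PropositionalEquality
  using (_≡_; _≢_; refl; sym; trans; cong; cong₂; subst; module ≡-Reasoning)
open import Relation.Nullary using (Dec; yes; no; does; contradiction)
open import Relation.Nullary.Decidable using (toSum)

module _ {a} {A : Set a} (_≟ₐ_ : DecidableEquality A) where

  swap : A → A → A → A
  swap i j k with does (k ≟ₐ i)
  ... | true = j
  ... | false with does (k ≟ₐ j)
  ...   | true = i
  ...   | false = k

  swap-left : ∀ {i j} → swap i j i ≡ j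
  swap-left {i} with i ≟ₐ i
  ... | yes _ = refl
  ... | no i≢i = contradiction refl i≢i

  swap-right : ∀ {i j} → swap i j j ≡ i
  swap-right {i} {j} with j ≟ₐ i
  ... | yes refl = refl
  ... | no _ with j ≟ₐ j
  ...   | yes _ = refl
  ...   | no j≢j = contradiction refl j≢j

  swap-other : ∀ {i j k} → k ≢ i → k ≢ j → swap i j k ≡ k
  swap-other {i} {j} {k} k≢i k≢j with k ≟ₐ i
  ... | yes k≡i = contradiction k≡i k≢i
  ... | no _ with k ≟ₐ j
  ...   | yes k≡j = contradiction k≡j k≢j
  ...   | no _ = refl

  swap-preserves : ∀ {i j} {b} {B : Set b} (g : A → B) → g i ≡ g j → ∀ k → g (swap i j k) ≡ g k
  swap-preserves {i} {j} g gi≡gj k with toSum (k ≟ₐ i) | toSum (k ≟ₐ j)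
  ... | inj₁ refl | _         = trans (cong g swap-left) (sym gi≡gj)
  ... | inj₂ _    | inj₁ refl = trans (cong g swap-right) gi≡gj
  ... | inj₂ k≢i  | inj₂ k≢j  = cong g (swap-other k≢i k≢j)

  swap-comm : ∀ {i j} k → swap i j k ≡ swap j i k
  swap-comm {i} {j} k with toSum (k ≟ₐ i) | toSum (k ≟ₐ j)
  ... | inj₁ refl | _         = trans (swap-left {j = j}) (sym (swap-right {j} {i}))
  ... | inj₂ _    | inj₁ refl = trans (swap-right {i}) (sym (swap-left {j} {i}))
  ... | inj₂ k≢i  | inj₂ k≢j  = trans (swap-other k≢i k≢j) (sym (swap-other k≢j k≢i))

  swap-involutive : ∀ {i j} k → swap i j (swap i j k) ≡ k
  swap-involutive {i} {j} k with toSum (k ≟ₐ i) | toSum (k ≟ₐ j)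
  ... | inj₁ refl | _         = trans (cong (swap i j) swap-left) swap-right
  ... | inj₂ _    | inj₁ refl = trans (cong (swap i j) swap-right) swap-left
  ... | inj₂ k≢i  | inj₂ k≢j  = trans (cong (swap i j) (swap-other k≢i k≢j)) (swap-other k≢i k≢j)

  swap-self : ∀ i k → swap i i k ≡ k
  swap-self i = swap-preserves (λ k → k) refl

  swap-injective : ∀ i j → Injective _≡_ _≡_ (swap i j)
  swap-injective i j {k} {l} e =
    trans (sym (swap-involutive k)) (trans (cong (swap i j) e) (swap-involutive l))

swap-conj : ∀ {a b} {A : Set a} {B : Set b} (_≟ₐ_ : DecidableEquality A) (_≟b_ : DecidableEquality B)
            (f : A → B) → Injective _≡_ _≡_ f →
            ∀ i j k → f (swap _≟ₐ_ i j k) ≡ swap _≟b_ (f i) (f j) (f k)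
swap-conj _≟ₐ_ _≟b_ f f-inj i j k with toSum (k ≟ₐ i) | toSum (k ≟ₐ j)
... | inj₁ refl | _         = trans (cong f (swap-left _≟ₐ_)) (sym (swap-left _≟b_))
... | inj₂ _    | inj₁ refl = trans (cong f (swap-right _≟ₐ_)) (sym (swap-right _≟b_))
... | inj₂ k≢i  | inj₂ k≢j  =
  trans (cong f (swap-other _≟ₐ_ k≢i k≢j)) (sym (swap-other _≟b_ (k≢i ∘ f-inj) (k≢j ∘ f-inj)))

swapℕ : ℕ → ℕ → ℕ → ℕ
swapℕ = swap _≟_

swapℕ-conj-adjacent : ∀ {A P} → A < P → ∀ n →
                      swapℕ P (suc P) (swapℕ A P (swapℕ P (suc P) n)) ≡ swapℕ A (suc P) n
swapℕ-conj-adjacent {A} {P} A<P n = begin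
  σ (swapℕ A P (σ n))        ≡⟨ swap-conj _≟_ _≟_ σ (swap-injective _≟_ P (suc P)) A P (σ n) ⟩
  swapℕ (σ A) (σ P) (σ (σ n)) ≡⟨ cong₂ (λ i j → swapℕ i j (σ (σ n))) σA≡A (swap-left _≟_ {P}) ⟩
  swapℕ A (suc P) (σ (σ n))   ≡⟨ cong (swapℕ A (suc P)) (swap-involutive _≟_ n) ⟩
  swapℕ A (suc P) n           ∎
  where
  open ≡-Reasoning
  σ : ℕ → ℕ
  σ = swapℕ P (suc P)
  σA≡A : σ A ≡ A
  σA≡A = swap-other _≟_ (<⇒≢ A<P) (<⇒≢ (m<n⇒m<1+n A<P))

swapFin : ∀ {n} → Fin n → Fin n → Fin n → Fin n
swapFin = swap F._≟_

transpose≗swapFin : ∀ {n} (i j k : Fin n) → PC.transpose i j k ≡ swapFin i j k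
transpose≗swapFin i j k with does (k F.≟ i)
... | true = refl
... | false with does (k F.≟ j)
...   | true = refl
...   | false = refl

toℕ-swapFin : ∀ {n} (i j k : Fin n) → toℕ (swapFin i j k) ≡ swapℕ (toℕ i) (toℕ j) (toℕ k)
toℕ-swapFin = swap-conj F._≟_ _≟_ toℕ toℕ-injective

toℕ-transpose : ∀ {n} (i j k : Fin n) → toℕ (PC.transpose i j k) ≡ swapℕ (toℕ i) (toℕ j) (toℕ k)
toℕ-transpose i j k = trans (cong toℕ (transpose≗swapFin i j k)) (toℕ-swapFin i j k)

toℕ-gen : ∀ {m} (k : Fin m) j → toℕ (gen k ⟨$⟩ʳ j) ≡ swapℕ (toℕ k) (suc (toℕ k)) (toℕ j)
toℕ-gen k j = trans (toℕ-transpose (inject₁ k) (F.suc k) j)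
                    (cong (λ i → swapℕ i (suc (toℕ k)) (toℕ j)) (toℕ-inject₁ k))

gen-left : ∀ {m} (s : Fin m) → gen s ⟨$⟩ʳ inject₁ s ≡ F.suc s
gen-left s = trans (transpose≗swapFin (inject₁ s) (F.suc s) (inject₁ s)) (swap-left F._≟_ {inject₁ s})

gen-other : ∀ {m} (s : Fin m) {y} → y ≢ inject₁ s → y ≢ F.suc s → gen s ⟨$⟩ʳ y ≡ y
gen-other s {y} y≢s y≢s+1 = trans (transpose≗swapFin (inject₁ s) (F.suc s) y) (swap-other F._≟_ y≢s y≢s+1)

eval-snoc : ∀ {m} (w : List (Fin m)) k i → eval (w ++ k ∷ []) ⟨$⟩ʳ i ≡ eval w ⟨$⟩ʳ (gen k ⟨$⟩ʳ i)
eval-snoc []      k i = refl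
eval-snoc (l ∷ w) k i = cong (gen l ⟨$⟩ʳ_) (eval-snoc w k i)

conj-transpose : ∀ {n} (x : Perm n) a b →
                 x · P.transpose a b ≈ P.transpose (x ⟨$⟩ʳ a) (x ⟨$⟩ʳ b) · x
conj-transpose x a b i = begin
  x ⟨$⟩ʳ PC.transpose a b i                              ≡⟨ cong (x ⟨$⟩ʳ_) (transpose≗swapFin a b i) ⟩
  x ⟨$⟩ʳ swapFin a b i                                   ≡⟨ swap-conj F._≟_ F._≟_ (x ⟨$⟩ʳ_) (Injection.injective (↔⇒↣ x)) a b i ⟩
  swapFin (x ⟨$⟩ʳ a) (x ⟨$⟩ʳ b) (x ⟨$⟩ʳ i)               ≡⟨ transpose≗swapFin (x ⟨$⟩ʳ a) (x ⟨$⟩ʳ b) (x ⟨$⟩ʳ i) ⟨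
  PC.transpose (x ⟨$⟩ʳ a) (x ⟨$⟩ʳ b) (x ⟨$⟩ʳ i)          ∎
  where open ≡-Reasoning

-- The blocks of J (the orbits of S_J) are numbered from the left; block J n counts the generators
-- outside J below position n.
block : ∀ {m} → Subset m → ℕ → ℕ
block _             zero    = 0
block []            (suc n) = 0
block (inside  ∷ J) (suc n) = block J n
block (outside ∷ J) (suc n) = suc (block J n)

block-suc-∈ : ∀ {m} (J : Subset m) (k : Fin m) → k ∈ J → block J (suc (toℕ k)) ≡ block J (toℕ k)
block-suc-∈ (inside  ∷ J) F.zero    here      = refl
block-suc-∈ (inside  ∷ J) (F.suc k) (there p) = block-suc-∈ J k p
block-suc-∈ (outside ∷ J) (F.suc k) (there p) = cong suc (block-suc-∈ J k p)

block-suc-∉ : ∀ {m} (J : Subset m) (k : Fin m) → k ∉ J → block J (suc (toℕ k)) ≡ suc (block J (toℕ k))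
block-suc-∉ (inside  ∷ J) F.zero    k∉J = contradiction here k∉J
block-suc-∉ (outside ∷ J) F.zero    k∉J = refl
block-suc-∉ (inside  ∷ J) (F.suc k) k∉J = block-suc-∉ J k (k∉J ∘ there)
block-suc-∉ (outside ∷ J) (F.suc k) k∉J = cong suc (block-suc-∉ J k (k∉J ∘ there))

block-mono-≤ : ∀ {m} (J : Subset m) {n n′} → n ≤ n′ → block J n ≤ block J n′
block-mono-≤ J             z≤n     = z≤n
block-mono-≤ []            (s≤s _) = z≤n
block-mono-≤ (inside  ∷ J) (s≤s p) = block-mono-≤ J p
block-mono-≤ (outside ∷ J) (s≤s p) = s≤s (block-mono-≤ J p)

block-≡⇒∈ : ∀ {m} (J : Subset m) {A B} → block J A ≡ block J B →
            ∀ (k : Fin m) → A ≤ toℕ k → toℕ k < B → k ∈ J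
block-≡⇒∈ J {A} {B} same k A≤k k<B with k ∈? J
... | yes k∈J = k∈J
... | no  k∉J = contradiction same (<⇒≢ (begin-strict
  block J A                 ≤⟨ block-mono-≤ J A≤k ⟩
  block J (toℕ k)           <⟨ n<1+n _ ⟩
  suc (block J (toℕ k))     ≡⟨ block-suc-∉ J k k∉J ⟨
  block J (suc (toℕ k))     ≤⟨ block-mono-≤ J k<B ⟩
  block J B                 ∎))
  where open ≤-Reasoning

gen-preserves-block : ∀ {m} (J : Subset m) {k} → k ∈ J → ∀ j →
                      block J (toℕ (gen k ⟨$⟩ʳ j)) ≡ block J (toℕ j)
gen-preserves-block J {k} k∈J j = begin
  block J (toℕ (PC.transpose (inject₁ k) (F.suc k) j)) ≡⟨ cong (block J ∘ toℕ) (transpose≗swapFin _ _ j) ⟩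
  block J (toℕ (swapFin (inject₁ k) (F.suc k) j))     ≡⟨ swap-preserves F._≟_ {inject₁ k} (block J ∘ toℕ) same-block j ⟩
  block J (toℕ j)                                     ∎
  where
  open ≡-Reasoning
  same-block : block J (toℕ (inject₁ k)) ≡ block J (suc (toℕ k))
  same-block = trans (cong (block J) (toℕ-inject₁ k)) (sym (block-suc-∈ J k k∈J))

parabolic-preserves-block : ∀ {m} (J : Subset m) {u} → InParabolic J u → ∀ j →
                            block J (toℕ (u ⟨$⟩ʳ j)) ≡ block J (toℕ j)
parabolic-preserves-block J (w , w⊆J , w≈u) j =
  trans (cong (block J ∘ toℕ) (sym (w≈u j))) (eval-preserves w w⊆J j)
  where
  eval-preserves : ∀ w → All (_∈ J) w → ∀ j → block J (toℕ (eval w ⟨$⟩ʳ j)) ≡ block J (toℕ j)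
  eval-preserves []      []          j = refl
  eval-preserves (k ∷ w) (k∈J ∷ w⊆J) j =
    trans (gen-preserves-block J k∈J (eval w ⟨$⟩ʳ j)) (eval-preserves w w⊆J j)

SwapWord : ∀ {m} → Subset m → ℕ → ℕ → Set
SwapWord J A B = ∃[ w ] (All (_∈ J) w × ∀ i → toℕ (eval w ⟨$⟩ʳ i) ≡ swapℕ A B (toℕ i))

swapWord-refl : ∀ {m} (J : Subset m) A → SwapWord J A A
swapWord-refl J A = [] , [] , λ i → sym (swap-self _≟_ A (toℕ i))

swapWord-comm : ∀ {m} {J : Subset m} {A B} → SwapWord J A B → SwapWord J B A
swapWord-comm (w , w⊆J , w≗) = w , w⊆J , λ i → trans (w≗ i) (swap-comm _≟_ (toℕ i))

-- The transposition (A B+1) is s_B (A B) s_B.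
swapWord-< : ∀ {m} (J : Subset m) {A B} → A < B → B ≤ m →
             (∀ (k : Fin m) → A ≤ toℕ k → toℕ k < B → k ∈ J) → SwapWord J A B
swapWord-< {m} J {A} {suc B} (s≤s A≤B) B<m inJ = extend (m≤n⇒m<n∨m≡n A≤B)
  where
  k : Fin m
  k = fromℕ< B<m
  toℕ-k : toℕ k ≡ B
  toℕ-k = toℕ-fromℕ< B<m
  k∈J : k ∈ J
  k∈J = inJ k (subst (A ≤_) (sym toℕ-k) A≤B) (subst (_< suc B) (sym toℕ-k) (n<1+n B))
  σ : ℕ → ℕ
  σ = swapℕ B (suc B)
  toℕ-gen-k : ∀ i → toℕ (gen k ⟨$⟩ʳ i) ≡ σ (toℕ i)
  toℕ-gen-k i = trans (toℕ-gen k i) (cong (λ b → swapℕ b (suc b) (toℕ i)) toℕ-k)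
  conjugate : SwapWord J A B → A < B → SwapWord J A (suc B)
  conjugate (w , w⊆J , w≗) A<B = k ∷ w ++ k ∷ [] , k∈J ∷ ++⁺ w⊆J (k∈J ∷ []) , λ i → begin
    toℕ (gen k ⟨$⟩ʳ (eval (w ++ k ∷ []) ⟨$⟩ʳ i)) ≡⟨ cong (λ j → toℕ (gen k ⟨$⟩ʳ j)) (eval-snoc w k i) ⟩
    toℕ (gen k ⟨$⟩ʳ (eval w ⟨$⟩ʳ (gen k ⟨$⟩ʳ i))) ≡⟨ toℕ-gen-k (eval w ⟨$⟩ʳ (gen k ⟨$⟩ʳ i)) ⟩
    σ (toℕ (eval w ⟨$⟩ʳ (gen k ⟨$⟩ʳ i)))         ≡⟨ cong σ (w≗ (gen k ⟨$⟩ʳ i)) ⟩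
    σ (swapℕ A B (toℕ (gen k ⟨$⟩ʳ i)))           ≡⟨ cong (σ ∘ swapℕ A B) (toℕ-gen-k i) ⟩
    σ (swapℕ A B (σ (toℕ i)))                     ≡⟨ swapℕ-conj-adjacent A<B (toℕ i) ⟩
    swapℕ A (suc B) (toℕ i)                       ∎
    where open ≡-Reasoning
  extend : A < B ⊎ A ≡ B → SwapWord J A (suc B)
  extend (inj₁ A<B) =
    conjugate (swapWord-< J A<B (≤-trans (n≤1+n B) B<m) (λ l A≤l l<B → inJ l A≤l (m<n⇒m<1+n l<B))) A<B
  extend (inj₂ A≡B) = k ∷ [] , k∈J ∷ [] , λ i →
    trans (toℕ-gen-k i) (cong (λ a → swapℕ a (suc B) (toℕ i)) (sym A≡B))

sameBlock⇒swapWord : ∀ {m} (J : Subset m) (a b : Fin (suc m)) →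
                     block J (toℕ a) ≡ block J (toℕ b) → SwapWord J (toℕ a) (toℕ b)
sameBlock⇒swapWord J a b same with <-cmp (toℕ a) (toℕ b)
... | tri< a<b _ _ = swapWord-< J a<b (≤-pred (toℕ<n b)) (block-≡⇒∈ J same)
... | tri≈ _ a≡b _ = subst (SwapWord J (toℕ a)) a≡b (swapWord-refl J (toℕ a))
... | tri> _ _ b<a = swapWord-comm (swapWord-< J b<a (≤-pred (toℕ<n a)) (block-≡⇒∈ J (sym same)))

sameBlock⇒transpose-parabolic : ∀ {m} (J : Subset m) (a b : Fin (suc m)) →
                                block J (toℕ a) ≡ block J (toℕ b) → InParabolic J (P.transpose a b)
sameBlock⇒transpose-parabolic J a b same with sameBlock⇒swapWord J a b same
... | w , w⊆J , w≗ = w , w⊆J , λ i → toℕ-injective (trans (w≗ i) (sym (toℕ-transpose a b i)))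

sum-mono-≤ : ∀ {n} {f g : Fin n → ℕ} → (∀ j → f j ≤ g j) → sum f ≤ sum g
sum-mono-≤ {zero}  f≤g = z≤n
sum-mono-≤ {suc n} f≤g = +-mono-≤ (f≤g F.zero) (sum-mono-≤ (f≤g ∘ F.suc))

sum-mono-< : ∀ {n} {f g : Fin n → ℕ} → (∀ j → f j ≤ g j) → ∀ a → f a < g a → sum f < sum g
sum-mono-< f≤g F.zero    fa<ga = +-mono-<-≤ fa<ga (sum-mono-≤ (f≤g ∘ F.suc))
sum-mono-< f≤g (F.suc a) fa<ga = +-mono-≤-< (f≤g F.zero) (sum-mono-< (f≤g ∘ F.suc) a fa<ga)

count : ∀ {n} → (Fin n → Bool) → ℕ
count f = sum λ j → if f j then 1 else 0

count-permute : ∀ {n} (f : Fin n → Bool) (π : Perm n) → count (f ∘ (π ⟨$⟩ʳ_)) ≡ count f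
count-permute f π = sym (sum-permute _ π)

count-cong : ∀ {n} {f g : Fin n → Bool} → (∀ j → f j ≡ g j) → count f ≡ count g
count-cong f≗g = sum-cong-≗ (cong (λ b → if b then 1 else 0) ∘ f≗g)

count-mono-< : ∀ {n} {f g : Fin n → Bool} → (∀ j → T (f j) → T (g j)) →
               ∀ a → ¬ T (f a) → T (g a) → count f < count g
count-mono-< f⇒g a ¬fa ga = sum-mono-< (λ j → indicator-mono (f⇒g j)) a (indicator-< ¬fa ga)
  where
  indicator-mono : ∀ {b c} → (T b → T c) → (if b then 1 else 0) ≤ (if c then 1 else 0)
  indicator-mono {false}         _   = z≤n
  indicator-mono {true}  {true}  _   = ≤-refl
  indicator-mono {true}  {false} b⇒c = ⊥-elim (b⇒c _)
  indicator-< : ∀ {b c} → ¬ T b → T c → (if b then 1 else 0) < (if c then 1 else 0)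
  indicator-< {true}          ¬b _ = ⊥-elim (¬b _)
  indicator-< {false} {true}  _  _ = s≤s z≤n

crossings : ∀ {m} → Subset m → Subset m → ℕ → ℕ → Perm (suc m) → ℕ
crossings J K β γ p = count λ j → (block J (toℕ j) ≡ᵇ β) ∧ (block K (toℕ (p ⟨$⟩ʳ j)) ≡ᵇ γ)

crossings-doubleCoset : ∀ {m} (J K : Subset m) β γ {u v p q : Perm (suc m)} →
                        InParabolic K v → InParabolic J u → (v · p) · u ≈ q →
                        crossings J K β γ p ≡ crossings J K β γ q
crossings-doubleCoset J K β γ {u} {v} {p} {q} v∈S_K u∈S_J vpu≈q =
  trans (sym (count-permute crossesAt u)) (count-cong λ j → cong₂ (λ b c → (b ≡ᵇ β) ∧ (c ≡ᵇ γ))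
    (parabolic-preserves-block J {u} u∈S_J j)
    (trans (sym (parabolic-preserves-block K {v} v∈S_K (p ⟨$⟩ʳ (u ⟨$⟩ʳ j)))) (cong (block K ∘ toℕ) (vpu≈q j))))
  where
  crossesAt : Fin _ → Bool
  crossesAt j = (block J (toℕ j) ≡ᵇ β) ∧ (block K (toℕ (p ⟨$⟩ʳ j)) ≡ᵇ γ)

crossings-gen-< : ∀ {m} (J K : Subset m) {s : Fin m} → s ∉ K → (x : Perm (suc m)) {a b : Fin (suc m)} →
                  x ⟨$⟩ʳ a ≡ inject₁ s → x ⟨$⟩ʳ b ≡ F.suc s → block J (toℕ a) ≢ block J (toℕ b) →
                  crossings J K (block J (toℕ a)) (block K (toℕ s)) (gen s · x) <
                  crossings J K (block J (toℕ a)) (block K (toℕ s)) x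
crossings-gen-< J K {s} s∉K x {a} {b} xa≡s xb≡s+1 a≁b = count-mono-< fewer a none-at-a one-at-a
  where
  β γ : ℕ
  β = block J (toℕ a)
  γ = block K (toℕ s)
  block-s : block K (toℕ (inject₁ s)) ≡ γ
  block-s = cong (block K) (toℕ-inject₁ s)
  block-sxa : block K (toℕ (gen s ⟨$⟩ʳ (x ⟨$⟩ʳ a))) ≡ suc γ
  block-sxa = trans (cong (block K ∘ toℕ) (trans (cong (gen s ⟨$⟩ʳ_) xa≡s) (gen-left s))) (block-suc-∉ K s s∉K)
  stays : ∀ j → block J (toℕ j) ≡ β →
          block K (toℕ (gen s ⟨$⟩ʳ (x ⟨$⟩ʳ j))) ≡ γ → block K (toℕ (x ⟨$⟩ʳ j)) ≡ γ
  stays j j∈β sxj∈γ with toSum (x ⟨$⟩ʳ j F.≟ inject₁ s) | toSum (x ⟨$⟩ʳ j F.≟ F.suc s)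
  ... | inj₁ xj≡s | _           = trans (cong (block K ∘ toℕ) xj≡s) block-s
  ... | inj₂ _    | inj₁ xj≡s+1 = contradiction (trans (sym j∈β) (cong (block J ∘ toℕ) j≡b)) a≁b
    where
    j≡b : j ≡ b
    j≡b = Injection.injective (↔⇒↣ x) (trans xj≡s+1 (sym xb≡s+1))
  ... | inj₂ xj≢s | inj₂ xj≢s+1 = trans (cong (block K ∘ toℕ) (sym (gen-other s xj≢s xj≢s+1))) sxj∈γ
  fewer : ∀ j → T ((block J (toℕ j) ≡ᵇ β) ∧ (block K (toℕ (gen s ⟨$⟩ʳ (x ⟨$⟩ʳ j))) ≡ᵇ γ)) →
                T ((block J (toℕ j) ≡ᵇ β) ∧ (block K (toℕ (x ⟨$⟩ʳ j)) ≡ᵇ γ))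
  fewer j h = let (j∈β , sxj∈γ) = Equivalence.to T-∧ h in
    Equivalence.from T-∧ (j∈β , ≡⇒≡ᵇ _ _ (stays j (≡ᵇ⇒≡ _ _ j∈β) (≡ᵇ⇒≡ _ _ sxj∈γ)))
  none-at-a : ¬ T ((β ≡ᵇ β) ∧ (block K (toℕ (gen s ⟨$⟩ʳ (x ⟨$⟩ʳ a))) ≡ᵇ γ))
  none-at-a h = 1+n≢n (trans (sym block-sxa) (≡ᵇ⇒≡ _ _ (proj₂ (Equivalence.to T-∧ h))))
  one-at-a : T ((β ≡ᵇ β) ∧ (block K (toℕ (x ⟨$⟩ʳ a)) ≡ᵇ γ))
  one-at-a = Equivalence.from T-∧ (≡⇒≡ᵇ β β refl , ≡⇒≡ᵇ _ _ (trans (cong (block K ∘ toℕ) xa≡s) block-s))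

word-avoiding⇒parabolic : ∀ {m} {s : Fin m} {w v} → ¬ Any (s ≡_) w → eval w ≈ v → InParabolic (∁ ⁅ s ⁆) v
word-avoiding⇒parabolic {w = w} s∉w w≈v =
  w , All.map (λ s≢k → x∉p⇒x∈∁p (x≢y⇒x∉⁅y⁆ (s≢k ∘ sym))) (¬Any⇒All¬ w s∉w) , w≈v

sameDoubleCoset⇒sameCoset : ∀ {m} (J : Subset m) (s : Fin m) {x v u : Perm (suc m)} →
                            InParabolic (∁ ⁅ s ⁆) v → InParabolic J u → (v · gen s · x) · u ≈ x →
                            SameCoset J x (gen s · x)
sameDoubleCoset⇒sameCoset J s {x} {v} {u} v∈S_K u∈S_J vsxu≈x = decide (block J (toℕ a) ≟ block J (toℕ b))
  where
  a b : Fin _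
  a = x ⟨$⟩ˡ inject₁ s
  b = x ⟨$⟩ˡ F.suc s
  K : Subset _
  K = ∁ ⁅ s ⁆
  β γ : ℕ
  β = block J (toℕ a)
  γ = block K (toℕ s)
  decide : Dec (block J (toℕ a) ≡ block J (toℕ b)) → SameCoset J x (gen s · x)
  decide (yes same) = P.transpose a b , sameBlock⇒transpose-parabolic J a b same , λ i →
    trans (conj-transpose x a b i) (cong₂ (λ c d → PC.transpose c d (x ⟨$⟩ʳ i)) (inverseʳ x) (inverseʳ x))
  decide (no differ) = ⊥-elim (<-irrefl
    (crossings-doubleCoset J K β γ {u} {v} {gen s · x} {x} v∈S_K u∈S_J vsxu≈x)
    (crossings-gen-< J K (x∈p⇒x∉∁p (x∈⁅x⁆ s)) x (inverseʳ x) (inverseʳ x) differ))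

lemma3p2 : (m : ℕ) (J : Subset m) (s : Fin m) (x v : Perm (suc m)) →
    SameCoset J (v · gen s · x) x →
    ¬ SameCoset J x (gen s · x) →
    InRw s v
lemma3p2 m J s x v (u , u∈S_J , vsxu≈x) x≁sx w (w≈v , _) with any? (s F.≟_) w
... | yes s∈w = s∈w
... | no  s∉w = ⊥-elim (x≁sx (sameDoubleCoset⇒sameCoset J s {x} {v} {u} v∈S_K u∈S_J vsxu≈x))
  where
  v∈S_K : InParabolic (∁ ⁅ s ⁆) v
  v∈S_K = word-avoiding⇒parabolic {s = s} {v = v} s∉w w≈v
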